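{- Let $m = p + 12k$ with $k \geqslant 0$ an integer and $p \in \{11,13,17,19\}$. If $G_{2m}$ admits three type-2 basic sets of dipaths and two type-1 basic sets of dipaths such that the dipaths and directed cycles in these five sets are pairwise arc-disjoint, then $G_{2m}$ admits a $\vec{C}_m$-factorization.
   Context: Let $m$ be odd. $G_{2m} = \vec{X}(m,\{1,3\}) \wr K^*_2$, where $\vec{X}(m,\{1,3\})$ has vertex set $\mathbb{Z}_m$ and arcs $(a,a+1),(a,a+3)$ (mod $m$), $K^*_2$ is the complete symmetric digraph on $\{x,y\}$, and the wreath product $G\wr H$ has vertex set $V(G)\times V(H)$ with an arc $(g_1,h_1)\to(g_2,h_2)$ iff $(g_1,g_2)\in A(G)$, or $g_1=g_2$ and $(h_1,h_2)\in A(H)$. Write $x_a=(a,x)$, $y_b=(b,y)$. An arc from a vertex with subscript $a$ to one with subscript $b$ has difference $b-a \bmod m$ (in $\{0,1,3\}$); a type-$k$ cycle is a directed $m$-cycle whose arc differences sum to $km$. $\rho(x_i)=x_{i+1}$, $\rho(y_i)=y_{i+1}$ (indices mod $m$). $V_0=\{x_0,\ldots,x_{p-1}\}\cup\{y_0,\ldots,y_{p-1}\}$ and, for $i=1,\ldots,k$, $V_i=\{x_t,y_t : p+12(i-1)\le t\le p+12i-1\}$. For a dipath $P$, $s(P)$, $t(P)$, $\mathrm{len}(P)$ are its first vertex, last vertex, number of arcs. A type-2 basic set of dipaths is an 8-tuple $(W,X,Y,Z,Q,R,S,T)$ of dipaths with: (C1) $Q,R,S,T$ pairwise disjoint; if $k\ge1$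 then $W,X,Y,Z$ pairwise disjoint, otherwise $WX$ and $YZ$ are disjoint type-2 directed cycles; (C2) $s(X)=\rho^{ -p}(t(W))$, $s(W)=\rho^{ -p}(t(X))$, $s(Z)=\rho^{ -p}(t(Y))$, $s(Y)=\rho^{ -p}(t(Z))$; (C3) $\mathrm{len}(W)+\mathrm{len}(X)=\mathrm{len}(Y)+\mathrm{len}(Z)=p$; $\mathrm{len}(Q)+\mathrm{len}(R)=\mathrm{len}(S)+\mathrm{len}(T)=12$ if $k\ge1$, all four of length $0$ otherwise; (C4) each of $W,X,Y,Z$ has source and internal vertices in $V_0$ and terminus $x_t$ or $y_t$ for some $t\in\{p,p+1,p+2\}$; (C5) $t(W)=s(Q)$, $t(X)=s(R)$, $t(Y)=s(S)$, $t(Z)=s(T)$; (C6) if $k\ge1$ and $P\in\{Q,R,S,T\}$ has $s(P)=x_t$ (resp. $y_t$) then $t(P)=x_{t+12}$ (resp. $y_{t+12}$) and its internal vertices lie in $V_1$. A type-1 basic set of dipaths is a 4-tuple $(X,Y,R,S)$ of dipaths or directed cycles with: (C1) $R,S$ disjoint; if $k\ge1$ then $X,Y$ are disjoint dipaths, otherwise disjoint type-1 directed cycles; (C2) $s(X)=\rho^{ -p}(t(X))$, $s(Y)=\rho^{ -p}(t(Y))$; (C3) $\mathrm{len}(X)=\mathrm{len}(Y)=p$; $\mathrm{len}(R)=\mathrm{len}(S)=12$ if $k\ge1$, $0$ if $k=0$; (C4) $X,Y$ have source and internal vertices in $V_0$ and terminus $x_t$ or $y_t$, $t\in\{p,p+1,p+2\}$;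 (C5) $t(X)=s(R)$, $t(Y)=s(S)$; (C6) if $k\ge1$ and $P\in\{R,S\}$ has $s(P)=x_t$ (resp. $y_t$) then $t(P)=x_{t+12}$ (resp. $y_{t+12}$) and its internal vertices lie in $V_1$. A $\vec{C}_m$-factorization is a partition of the arc set into spanning subdigraphs each a disjoint union of directed $m$-cycles. -}

module Defs where

open import Data.Nat using (ℕ; zero; suc; _+_; _*_; _≤_; _<_)
open import Data.Fin using (Fin; toℕ)
open import Data.List using (List; []; _∷_; _++_; length; concatMap; lookup)
open import Data.List.Membership.Propositional using (_∈_)
open import Data.List.Relation.Unary.Linked using (Linked)
open import Data.List.Relation.Unary.Unique.Propositional using (Unique)
open import Data.Product using (Σ; ∃; ∃₂; _×_; _,_)
open import Data.Sum using (_⊎_)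
open import Data.Empty using (⊥)
open import Relation.Binary.PropositionalEquality using (_≡_; _≢_)

-- Arithmetic modulo m without division:  a ≡ b (mod m)

ModEq : ℕ → ℕ → ℕ → Set
ModEq m a b = ∃₂ λ i j → a + i * m ≡ b + j * m

-- The digraph G_{2m} = X(m,{1,3}) ≀ K*_2

data Side : Set where
  x y : Side

-- vertex (s , a) is x_a if s = x and y_a if s = y, a ∈ ℤ_m
Vtx : ℕ → Set
Vtx m = Side × Fin m

side : ∀ {m} → Vtx m → Side
side (s , _) = s

idx : ∀ {m} → Vtx m → ℕ
idx (_ , a) = toℕ a

-- Either the first coordinates differ by 1 or 3 (mod m), sides arbitrary
-- (arc of X(m,{1,3})), or they are equal and the sides differ (arc of K*_2).
ArcD : (m : ℕ) → Vtx m → Vtx m → ℕ → Set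
ArcD m u v d =
  (d ≡ 0 × idx u ≡ idx v × side u ≢ side v)
  ⊎ ((d ≡ 1 ⊎ d ≡ 3) × ModEq m (idx u + d) (idx v))

Arc : (m : ℕ) → Vtx m → Vtx m → Set
Arc m u v = ∃ λ d → ArcD m u v d

record Walk (m : ℕ) : Set where
  constructor _▸_
  field
    start : Vtx m
    rest  : List (Vtx m)
open Walk public

verts : ∀ {m} → Walk m → List (Vtx m)
verts (s ▸ r) = s ∷ r

lastV : ∀ {m} → Vtx m → List (Vtx m) → Vtx m
lastV s []       = s
lastV s (v ∷ vs) = lastV v vs

src : ∀ {m} → Walk m → Vtx m
src = start

term : ∀ {m} → Walk m → Vtx m
term (s ▸ r) = lastV s r

len : ∀ {m} → Walk m → ℕ
len P = length (rest P)

initV : ∀ {m} → Vtx m → List (Vtx m) → List (Vtx m)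
initV s []       = []
initV s (v ∷ vs) = s ∷ initV v vs

srcAndInternal : ∀ {m} → Walk m → List (Vtx m)
srcAndInternal (s ▸ r) = initV s r

internal : ∀ {m} → Walk m → List (Vtx m)
internal (s ▸ [])     = []
internal (s ▸ (v ∷ vs)) = initV v vs

arcsFrom : ∀ {m} → Vtx m → List (Vtx m) → List (Vtx m × Vtx m)
arcsFrom s []       = []
arcsFrom s (v ∷ vs) = (s , v) ∷ arcsFrom v vs

arcs : ∀ {m} → Walk m → List (Vtx m × Vtx m)
arcs (s ▸ r) = arcsFrom s r

-- concatenation W X (meaningful when s(X) = t(W))
_⊙_ : ∀ {m} → Walk m → Walk m → Walk m
(s ▸ r) ⊙ (_ ▸ r') = s ▸ (r ++ r')

data Weight (m : ℕ) : Vtx m → List (Vtx m) → ℕ → Set where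
  nil  : ∀ {s} → Weight m s [] 0
  cons : ∀ {s v vs d w} → ArcD m s v d → Weight m v vs w → Weight m s (v ∷ vs) (d + w)

IsDipath : (m : ℕ) → Walk m → Set
IsDipath m P = Linked (Arc m) (verts P) × Unique (verts P)

-- a directed cycle: closed walk of positive length whose vertices
-- (listed once each by 'rest') are distinct
IsDirCycle : (m : ℕ) → Walk m → Set
IsDirCycle m P =
  Linked (Arc m) (verts P) × term P ≡ start P × Unique (rest P) × 1 ≤ len P

-- directed m-cycle of type k: arc differences sum to k m
IsTypeCycle : (m k : ℕ) → Walk m → Set
IsTypeCycle m k P =
  IsDirCycle m P × len P ≡ m × Weight m (start P) (rest P) (k * m)

VDisjoint : ∀ {A : Set} → List A → List A → Set
VDisjoint as bs = ∀ {v} → v ∈ as → v ∈ bs → ⊥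

Disj : ∀ {m} → Walk m → Walk m → Set
Disj P P' = VDisjoint (verts P) (verts P')

-- u = ρ^{-p}(v)   (equivalently ρ^p(u) = v)
IsRhoInvP : (m p : ℕ) → Vtx m → Vtx m → Set
IsRhoInvP m p u v = side u ≡ side v × ModEq m (idx u + p) (idx v)

C4 : (m p : ℕ) → Walk m → Set
C4 m p P =
  (∀ {v} → v ∈ srcAndInternal P → idx v < p)
  × (∃ λ j → j < 3 × ModEq m (idx (term P)) (p + j))

C6 : (m p : ℕ) → Walk m → Set
C6 m p P =
  side (term P) ≡ side (src P)
  × ModEq m (idx (term P)) (idx (src P) + 12)
  × (∀ {v} → v ∈ internal P → p ≤ idx v × idx v < p + 12)

record Type2Basic (p k : ℕ) : Set where
  field
    W X Y Z Q R S T : Walk (p + 12 * k)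
  m = p + 12 * k
  field
    dipaths : IsDipath m W × IsDipath m X × IsDipath m Y × IsDipath m Z
              × IsDipath m Q × IsDipath m R × IsDipath m S × IsDipath m T
    C1-QRST : Disj Q R × Disj Q S × Disj Q T × Disj R S × Disj R T × Disj S T
    C1-pos  : 1 ≤ k →
              Disj W X × Disj W Y × Disj W Z × Disj X Y × Disj X Z × Disj Y Z
    C1-zero : k ≡ 0 →
              IsTypeCycle m 2 (W ⊙ X) × IsTypeCycle m 2 (Y ⊙ Z)
              × VDisjoint (rest (W ⊙ X)) (rest (Y ⊙ Z))
    C2 : IsRhoInvP m p (src X) (term W) × IsRhoInvP m p (src W) (term X)
         × IsRhoInvP m p (src Z) (term Y) × IsRhoInvP m p (src Y) (term Z)
    C3 : len W + len X ≡ p × len Y + len Z ≡ p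
    C3-pos  : 1 ≤ k → len Q + len R ≡ 12 × len S + len T ≡ 12
    C3-zero : k ≡ 0 → len Q ≡ 0 × len R ≡ 0 × len S ≡ 0 × len T ≡ 0
    C4s : C4 m p W × C4 m p X × C4 m p Y × C4 m p Z
    C5 : term W ≡ src Q × term X ≡ src R × term Y ≡ src S × term Z ≡ src T
    C6s : 1 ≤ k → C6 m p Q × C6 m p R × C6 m p S × C6 m p T

  walks : List (Walk m)
  walks = W ∷ X ∷ Y ∷ Z ∷ Q ∷ R ∷ S ∷ T ∷ []

record Type1Basic (p k : ℕ) : Set where
  field
    X Y R S : Walk (p + 12 * k)
  m = p + 12 * k
  field
    C1-RS   : IsDipath m R × IsDipath m S × Disj R S
    C1-pos  : 1 ≤ k → IsDipath m X × IsDipath m Y × Disj X Y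
    C1-zero : k ≡ 0 → IsTypeCycle m 1 X × IsTypeCycle m 1 Y
                      × VDisjoint (rest X) (rest Y)
    C2 : IsRhoInvP m p (src X) (term X) × IsRhoInvP m p (src Y) (term Y)
    C3 : len X ≡ p × len Y ≡ p
    C3-pos  : 1 ≤ k → len R ≡ 12 × len S ≡ 12
    C3-zero : k ≡ 0 → len R ≡ 0 × len S ≡ 0
    C4s : C4 m p X × C4 m p Y
    C5 : term X ≡ src R × term Y ≡ src S
    C6s : 1 ≤ k → C6 m p R × C6 m p S

  walks : List (Walk m)
  walks = X ∷ Y ∷ R ∷ S ∷ []

PairwiseArcDisjoint : ∀ {m} → List (Walk m) → Set
PairwiseArcDisjoint ws =
  ∀ (i j : Fin (length ws)) → i ≢ j → VDisjoint (arcs (lookup ws i)) (arcs (lookup ws j))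

record CmFactorization (m : ℕ) : Set where
  field
    factors   : List (List (Walk m))
    cycles    : ∀ {F} → F ∈ factors → ∀ {C} → C ∈ F → IsDirCycle m C × len C ≡ m
    spanning  : ∀ {F} → F ∈ factors → ∀ (v : Vtx m) → v ∈ concatMap rest F
    vdisjoint : ∀ {F} → F ∈ factors → Unique (concatMap rest F)
    arcsOnce  : Unique (concatMap (concatMap arcs) factors)
    arcsAll   : ∀ (u v : Vtx m) → Arc m u v → (u , v) ∈ concatMap (concatMap arcs) factors

module Submission where

-- A type-2 basic set (W,X,Y,Z,Q,R,S,T) yields the factor made of the two closed walks
-- W Q ρ¹²Q … ρ^{12(k-1)}Q X R ρ¹²R … ρ^{12(k-1)}R and Y S … Z T …, a type-1 basic set (X,Y,R,S)
-- the factor made of X R ρ¹²R … ρ^{12(k-1)}R and Y S … ρ^{12(k-1)}S. By (C5) and (C6) consecutive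
-- pieces meet, by (C2) each walk closes up because ρ^{p+12k} = ρ^m is the identity, and by (C3) it
-- has length p + 12k = m. The long dipaths start only from vertices with subscript < p and the copy
-- ρ^{12j} of a short one only from subscripts in [p+12j, p+12j+12), so pieces in different such
-- layers share no vertex and no arc; inside a layer, (C1) (or, for k = 0, the given cycles) keeps
-- the pieces of one factor vertex-disjoint and the hypothesis keeps all pieces arc-disjoint. Hence
-- every factor passes through 2m distinct vertices, i.e. through all of them, and the five factors
-- use 10m distinct arcs, which by counting (every vertex has out-degree 5) are all arcs of G_{2m}.

open import Defs
open import Data.Nat using (ℕ; zero; suc; _+_; _*_; _≤_; _<_; z≤n; s≤s; NonZero; >-nonZero; ≢-nonZero⁻¹)
open import Data.Nat.Properties
  using (_≟_; ≤-refl; ≤-trans; <-≤-trans; ≤-<-trans; ≤-reflexive; ≤-antisym; <-irrefl; <⇒≱; m<1+n⇒m≤n;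
         n≤1+n; m≤m+n; n≢0⇒n>0; +-assoc; +-suc; +-identityʳ; +-cancelʳ-≡; +-cancelˡ-<; *-suc; *-comm;
         *-zeroʳ; *-cancelˡ-<; +-monoˡ-≤; +-monoʳ-≤; +-monoˡ-<; +-monoʳ-<; *-monoʳ-≤)
open import Data.Nat.DivMod
  using (_%_; _/_; _mod_; m≡m%n+[m/n]*n; [m+kn]%n≡m%n; [m+n]%n≡m%n; %-distribˡ-+; m<n⇒m%n≡m; m%n%n≡m%n)
open import Data.Nat.ListAction using (sum)
open import Data.Nat.Solver using (module +-*-Solver)
open import Data.Fin using (Fin; toℕ; #_) renaming (_≟_ to _≟ᶠ_)
open import Data.Fin.Properties using (toℕ-injective; toℕ-fromℕ<; toℕ<n)
open import Data.List using (List; []; _∷_; _++_; _∷ʳ_; length; map; concatMap; allFin; lookup)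
open import Data.List.Properties
  using (length-++; length-map; length-tabulate; map-++; map-∘; concatMap-++; concatMap-map; map-concatMap)
open import Data.List.NonEmpty using (List⁺; _∷_; toList; head)
import Data.List.NonEmpty as List⁺
open import Data.List.Membership.Propositional using (_∈_; find)
open import Data.List.Membership.Propositional.Properties
  using (∈-++⁺ˡ; ∈-++⁺ʳ; ∈-++⁻; ∈-∃++; ∈-map⁺; ∈-map⁻; ∈-allFin; ∈-concatMap⁺; ∈-concatMap⁻)
import Data.List.Membership.DecPropositional as DecMembership
open import Data.List.Relation.Unary.Any using (here; there)
import Data.List.Relation.Unary.Any as Any
open import Data.List.Relation.Unary.All using (All; []; _∷_)
import Data.List.Relation.Unary.All as All
import Data.List.Relation.Unary.All.Properties as All
open import Data.List.Relation.Unary.AllPairs using (AllPairs; []; _∷_)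
import Data.List.Relation.Unary.AllPairs.Properties as AllPairs
open import Data.List.Relation.Unary.Linked using (Linked; []; [-]; _∷_)
import Data.List.Relation.Unary.Linked as Linked
import Data.List.Relation.Unary.Linked.Properties as Linked
open import Data.List.Relation.Unary.Unique.Propositional using (Unique)
import Data.List.Relation.Unary.Unique.Propositional.Properties as Unique
open import Data.List.Relation.Unary.Unique.DecPropositional (_≟ᶠ_ {32}) using (unique?)
open import Data.List.Relation.Binary.Disjoint.Propositional using (Disjoint)
open import Data.List.Relation.Binary.Permutation.Propositional
  using (_↭_; ↭-refl; ↭-sym; ↭-trans; ↭-reflexive; ↭⇒↭ₛ; module PermutationReasoning)
open import Data.List.Relation.Binary.Permutation.Propositional.Properties using (++⁺; ∷↭∷ʳ; drop-∷; ∈-resp-↭)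
import Data.List.Relation.Binary.Permutation.Setoid.Properties as Permutationₛ
open import Data.Product using (∃; _×_; _,_; proj₁; proj₂)
import Data.Product as Product
open import Data.Product.Properties using (≡-dec)
open import Data.Sum using (_⊎_; inj₁; inj₂)
open import Data.Unit using (⊤)
open import Data.Empty using (⊥-elim)
open import Function using (_∘_; Injective)
open import Relation.Nullary using (yes; no)
open import Relation.Nullary.Decidable using (toWitness)
open import Relation.Binary using (Symmetric; DecidableEquality)
open import Relation.Binary.PropositionalEquality
  using (_≡_; _≢_; refl; sym; trans; cong; cong₂; subst; subst₂; setoid; module ≡-Reasoning)

module _ {A : Set} where

  allPairs-of-distinct : ∀ {R : A → A → Set} {as} → Unique as →
                         (∀ {a b} → a ∈ as → b ∈ as → a ≢ b → R a b) → AllPairs R as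
  allPairs-of-distinct []         _          = []
  allPairs-of-distinct (a∉ ∷ uas) R-distinct =
    All.tabulate (λ b∈ → R-distinct (here refl) (there b∈) (All.lookup a∉ b∈))
    ∷ allPairs-of-distinct uas (λ a∈ b∈ → R-distinct (there a∈) (there b∈))

  allPairs⇒distinct : ∀ {R : A → A → Set} {as a b} → Symmetric R → AllPairs R as →
                      a ∈ as → b ∈ as → a ≢ b → R a b
  allPairs⇒distinct _     (_ ∷ _)   (here refl) (here refl) a≢b = ⊥-elim (a≢b refl)
  allPairs⇒distinct _     (Ra ∷ _)  (here refl) (there b∈)  _   = All.lookup Ra b∈
  allPairs⇒distinct R-sym (Ra ∷ _)  (there a∈)  (here refl) _   = R-sym (All.lookup Ra a∈)
  allPairs⇒distinct R-sym (_ ∷ Ras) (there a∈)  (there b∈)  a≢b = allPairs⇒distinct R-sym Ras a∈ b∈ a≢b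

  unique-++ˡ : ∀ (as : List A) {bs} → Unique (as ++ bs) → Unique as
  unique-++ˡ []       _          = []
  unique-++ˡ (a ∷ as) (a∉ ∷ uas) = All.tabulate (λ b∈ → All.lookup a∉ (∈-++⁺ˡ b∈)) ∷ unique-++ˡ as uas

  unique-++ʳ : ∀ (as : List A) {bs} → Unique (as ++ bs) → Unique bs
  unique-++ʳ []       u         = u
  unique-++ʳ (_ ∷ as) (_ ∷ uas) = unique-++ʳ as uas

  unique-++⇒disjoint : ∀ (as : List A) {bs} → Unique (as ++ bs) → Disjoint as bs
  unique-++⇒disjoint (a ∷ as) (a∉ ∷ _)  (here refl , a∈bs)  = All.lookup a∉ (∈-++⁺ʳ as a∈bs) refl
  unique-++⇒disjoint (a ∷ as) (_ ∷ uas) (there v∈as , v∈bs) = unique-++⇒disjoint as uas (v∈as , v∈bs)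

  map-disjoint : ∀ {B : Set} {f : A → B} {as bs} → Injective _≡_ _≡_ f →
                 Disjoint as bs → Disjoint (map f as) (map f bs)
  map-disjoint {f = f} f-inj as#bs (fa∈ , fb∈) with ∈-map⁻ f fa∈ | ∈-map⁻ f fb∈
  ... | a , a∈ , refl | b , b∈ , fa≡fb = as#bs (a∈ , subst (_∈ _) (f-inj (sym fa≡fb)) b∈)

  unique-⊆⇒length≤ : ∀ {as bs : List A} → Unique as → (∀ {v} → v ∈ as → v ∈ bs) → length as ≤ length bs
  unique-⊆⇒length≤ {[]}     _          _     = z≤n
  unique-⊆⇒length≤ {a ∷ as} (a∉ ∷ uas) as⊆bs with ∈-∃++ (as⊆bs (here refl))
  ... | bs₁ , bs₂ , refl =
    subst (suc (length as) ≤_) (sym length-split) (s≤s (unique-⊆⇒length≤ uas drop-a))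
    where
    length-split : length (bs₁ ++ a ∷ bs₂) ≡ suc (length (bs₁ ++ bs₂))
    length-split = trans (length-++ bs₁) (trans (+-suc (length bs₁) _) (cong suc (sym (length-++ bs₁))))
    drop-a : ∀ {v} → v ∈ as → v ∈ bs₁ ++ bs₂
    drop-a v∈ with ∈-++⁻ bs₁ (as⊆bs (there v∈))
    ... | inj₁ v∈bs₁         = ∈-++⁺ˡ v∈bs₁
    ... | inj₂ (here refl)   = ⊥-elim (All.lookup a∉ v∈ refl)
    ... | inj₂ (there v∈bs₂) = ∈-++⁺ʳ bs₁ v∈bs₂

  ⊆-length⇒⊇ : DecidableEquality A → ∀ {as bs : List A} → Unique as → (∀ {v} → v ∈ as → v ∈ bs) →
               length bs ≤ length as → ∀ {v} → v ∈ bs → v ∈ as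
  ⊆-length⇒⊇ _≟ₐ_ {as} uas as⊆bs bs≤as {v} v∈bs with DecMembership._∈?_ _≟ₐ_ v as
  ... | yes v∈as = v∈as
  ... | no  v∉as = ⊥-elim (<-irrefl refl (≤-trans (unique-⊆⇒length≤ (fresh ∷ uas) v∷as⊆bs) bs≤as))
    where
    fresh : All (v ≢_) as
    fresh = All.tabulate λ { w∈ refl → v∉as w∈ }
    v∷as⊆bs : ∀ {w} → w ∈ v ∷ as → w ∈ _
    v∷as⊆bs (here refl) = v∈bs
    v∷as⊆bs (there w∈)  = as⊆bs w∈

  unique-resp-↭ : ∀ {as bs : List A} → as ↭ bs → Unique as → Unique bs
  unique-resp-↭ as↭bs = Permutationₛ.Unique-resp-↭ (setoid A) (↭⇒↭ₛ as↭bs)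

module _ {A B : Set} where

  concatMap-unique : ∀ {f : A → List B} {as} → Unique as → (∀ {a} → a ∈ as → Unique (f a)) →
                     (∀ {a b} → a ∈ as → b ∈ as → a ≢ b → Disjoint (f a) (f b)) → Unique (concatMap f as)
  concatMap-unique uas uf f# =
    Unique.concat⁺ (All.map⁺ (All.tabulate uf)) (AllPairs.map⁺ (allPairs-of-distinct uas f#))

  concatMap-unique⁻ : ∀ (f : A → List B) {as a} → a ∈ as → Unique (concatMap f as) → Unique (f a)
  concatMap-unique⁻ f {a ∷ as} (here refl) u = unique-++ˡ (f a) u
  concatMap-unique⁻ f {a ∷ as} (there a∈)  u = concatMap-unique⁻ f a∈ (unique-++ʳ (f a) u)

  length-concatMap : ∀ {f : A → List B} {n} as → (∀ {a} → a ∈ as → length (f a) ≡ n) →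
                     length (concatMap f as) ≡ length as * n
  length-concatMap         []       _     = refl
  length-concatMap {f} (a ∷ as) len-f =
    trans (length-++ (f a)) (cong₂ _+_ (len-f (here refl)) (length-concatMap as (len-f ∘ there)))

  concatMap-cong-∈ : ∀ {f h : A → List B} as → (∀ {a} → a ∈ as → f a ≡ h a) →
                     concatMap f as ≡ concatMap h as
  concatMap-cong-∈ []       _   = refl
  concatMap-cong-∈ (a ∷ as) f≡h = cong₂ _++_ (f≡h (here refl)) (concatMap-cong-∈ as (f≡h ∘ there))

  concatMap-↭ : ∀ {f h : A → List B} as → (∀ {a} → a ∈ as → f a ↭ h a) →
                concatMap f as ↭ concatMap h as
  concatMap-↭ []       _   = ↭-refl
  concatMap-↭ (a ∷ as) f↭h = ++⁺ (f↭h (here refl)) (concatMap-↭ as (f↭h ∘ there))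

concatMap-concatMap : ∀ {A B C : Set} (f : B → List C) (g : A → List B) as →
                      concatMap f (concatMap g as) ≡ concatMap (concatMap f ∘ g) as
concatMap-concatMap f g []       = refl
concatMap-concatMap f g (a ∷ as) =
  trans (concatMap-++ f (g a) (concatMap g as)) (cong (concatMap f (g a) ++_) (concatMap-concatMap f g as))


module Graph (m : ℕ) .{{_ : NonZero m}} where

  open +-*-Solver using (solve; _:+_; _:=_)

  infix 4 _≈_
  _≈_ : ℕ → ℕ → Set
  a ≈ b = a % m ≡ b % m

  modEq⇒≈ : ∀ {a b} → ModEq m a b → a ≈ b
  modEq⇒≈ {a} {b} (i , j , e) =
    trans (sym ([m+kn]%n≡m%n a i m)) (trans (cong (_% m) e) ([m+kn]%n≡m%n b j m))

  ≈⇒modEq : ∀ {a b} → a ≈ b → ModEq m a b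
  ≈⇒modEq {a} {b} a≈b = b / m , a / m , (begin
    a + b / m * m                      ≡⟨ cong (_+ b / m * m) (m≡m%n+[m/n]*n a m) ⟩
    a % m + a / m * m + b / m * m      ≡⟨ cong (λ r → r + a / m * m + b / m * m) a≈b ⟩
    b % m + a / m * m + b / m * m      ≡⟨ solve 3 (λ r s t → r :+ s :+ t := r :+ t :+ s) refl (b % m) (a / m * m) (b / m * m) ⟩
    b % m + b / m * m + a / m * m      ≡⟨ cong (_+ a / m * m) (sym (m≡m%n+[m/n]*n b m)) ⟩
    b + a / m * m                      ∎)
    where open ≡-Reasoning

  ≈-+ʳ : ∀ {a b} c → a ≈ b → a + c ≈ b + c
  ≈-+ʳ {a} {b} c a≈b = trans (%-distribˡ-+ a c m)
    (trans (cong (λ r → (r + c % m) % m) a≈b) (sym (%-distribˡ-+ b c m)))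

  ≈-cancel-+ʳ : ∀ {a b} c → a + c ≈ b + c → a ≈ b
  ≈-cancel-+ʳ {a} {b} c a+c≈b+c with ≈⇒modEq a+c≈b+c
  ... | i , j , e = modEq⇒≈ (i , j , +-cancelʳ-≡ c (a + i * m) (b + j * m) (begin
    a + i * m + c   ≡⟨ solve 3 (λ a c t → a :+ t :+ c := a :+ c :+ t) refl a c (i * m) ⟩
    a + c + i * m   ≡⟨ e ⟩
    b + c + j * m   ≡⟨ solve 3 (λ b c t → b :+ c :+ t := b :+ t :+ c) refl b c (j * m) ⟩
    b + j * m + c   ∎))
    where open ≡-Reasoning

  +m≈ : ∀ a → a + m ≈ a
  +m≈ a = [m+n]%n≡m%n a m

  ≈⇒≡ : ∀ {a b} → a < m → b < m → a ≈ b → a ≡ b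
  ≈⇒≡ a<m b<m a≈b = trans (sym (m<n⇒m%n≡m a<m)) (trans a≈b (m<n⇒m%n≡m b<m))

  V : Set
  V = Vtx m

  vtx-≡ : ∀ {u v : V} → side u ≡ side v → idx u ≡ idx v → u ≡ v
  vtx-≡ {s , a} {.s , b} refl a≡b = cong (s ,_) (toℕ-injective a≡b)

  idx<m : ∀ (v : V) → idx v < m
  idx<m (_ , a) = toℕ<n a

  rot : ℕ → V → V
  rot r (s , a) = s , (toℕ a + r) mod m

  side-rot : ∀ r v → side (rot r v) ≡ side v
  side-rot r (s , a) = refl

  idx-rot : ∀ r v → idx (rot r v) ≡ (idx v + r) % m
  idx-rot r (s , a) = toℕ-fromℕ< _

  idx-rot≈ : ∀ r v → idx (rot r v) ≈ idx v + r
  idx-rot≈ r v = trans (cong (_% m) (idx-rot r v)) (m%n%n≡m%n _ m)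

  idx-rot-small : ∀ r v → idx v + r < m → idx (rot r v) ≡ idx v + r
  idx-rot-small r v lt = trans (idx-rot r v) (m<n⇒m%n≡m lt)

  rot-≡ : ∀ {u v r r′} → side u ≡ side v → idx u + r ≈ idx v + r′ → rot r u ≡ rot r′ v
  rot-≡ {u} {v} {r} {r′} su≡sv e = vtx-≡ (trans (side-rot r u) (trans su≡sv (sym (side-rot r′ v))))
    (trans (idx-rot r u) (trans e (sym (idx-rot r′ v))))

  rot-zero : ∀ v → rot 0 v ≡ v
  rot-zero v = vtx-≡ (side-rot 0 v) (trans (idx-rot 0 v)
    (trans (cong (_% m) (+-identityʳ (idx v))) (m<n⇒m%n≡m (idx<m v))))

  rot-rot : ∀ r r′ v → rot r (rot r′ v) ≡ rot (r′ + r) v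
  rot-rot r r′ v = rot-≡ {rot r′ v} {v} {r} {r′ + r} (side-rot r′ v)
    (trans (≈-+ʳ r (idx-rot≈ r′ v)) (cong (_% m) (+-assoc (idx v) r′ r)))

  rot-injective : ∀ {r u v} → rot r u ≡ rot r v → u ≡ v
  rot-injective {r} {u} {v} e = vtx-≡
    (trans (sym (side-rot r u)) (trans (cong side e) (side-rot r v)))
    (≈⇒≡ (idx<m u) (idx<m v) (≈-cancel-+ʳ r
      (trans (sym (idx-rot≈ r u)) (trans (cong (_% m) (cong idx e)) (idx-rot≈ r v)))))

  rot-arcD : ∀ r {u v d} → ArcD m u v d → ArcD m (rot r u) (rot r v) d
  rot-arcD r {s , a} {t , b} (inj₁ (d≡0 , a≡b , s≢t)) =
    inj₁ (d≡0 , cong (λ c → toℕ ((c + r) mod m)) a≡b , s≢t)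
  rot-arcD r {u} {v} {d} (inj₂ (d∈13 , u+d≡v)) = inj₂ (d∈13 , ≈⇒modEq (begin
    (idx (rot r u) + d) % m   ≡⟨ ≈-+ʳ d (idx-rot≈ r u) ⟩
    (idx u + r + d) % m       ≡⟨ cong (_% m) (solve 3 (λ a r d → a :+ r :+ d := a :+ d :+ r) refl (idx u) r d) ⟩
    (idx u + d + r) % m       ≡⟨ ≈-+ʳ r (modEq⇒≈ u+d≡v) ⟩
    (idx v + r) % m           ≡⟨ sym (idx-rot≈ r v) ⟩
    idx (rot r v) % m         ∎))
    where open ≡-Reasoning

  rot-arc : ∀ r {u v} → Arc m u v → Arc m (rot r u) (rot r v)
  rot-arc r (d , a) = d , rot-arcD r a

  rot² : ℕ → V × V → V × V
  rot² r (u , v) = rot r u , rot r v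

  rot²-injective : ∀ {r a b} → rot² r a ≡ rot² r b → a ≡ b
  rot²-injective {a = _ , _} {_ , _} e =
    cong₂ _,_ (rot-injective (cong proj₁ e)) (rot-injective (cong proj₂ e))

  _≟ˢ_ : DecidableEquality Side
  x ≟ˢ x = yes refl
  x ≟ˢ y = no λ ()
  y ≟ˢ x = no λ ()
  y ≟ˢ y = yes refl

  _≟ᵛ_ : DecidableEquality V
  _≟ᵛ_ = ≡-dec _≟ˢ_ _≟ᶠ_

  _≟ᵃ_ : DecidableEquality (V × V)
  _≟ᵃ_ = ≡-dec _≟ᵛ_ _≟ᵛ_

  lastV-map : ∀ (f : V → V) s vs → lastV (f s) (map f vs) ≡ f (lastV s vs)
  lastV-map f s []       = refl
  lastV-map f s (v ∷ vs) = lastV-map f v vs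

  initV-map : ∀ (f : V → V) s vs → initV (f s) (map f vs) ≡ map f (initV s vs)
  initV-map f s []       = refl
  initV-map f s (v ∷ vs) = cong (f s ∷_) (initV-map f v vs)

  arcsFrom-map : ∀ (f : V → V) s vs →
                 arcsFrom (f s) (map f vs) ≡ map (λ a → f (proj₁ a) , f (proj₂ a)) (arcsFrom s vs)
  arcsFrom-map f s []       = refl
  arcsFrom-map f s (v ∷ vs) = cong ((f s , f v) ∷_) (arcsFrom-map f v vs)

  lastV-++ : ∀ (s : V) us vs → lastV s (us ++ vs) ≡ lastV (lastV s us) vs
  lastV-++ s []       vs = refl
  lastV-++ s (u ∷ us) vs = lastV-++ u us vs

  initV-++ : ∀ (s : V) us vs → initV s (us ++ vs) ≡ initV s us ++ initV (lastV s us) vs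
  initV-++ s []       vs = refl
  initV-++ s (u ∷ us) vs = cong (s ∷_) (initV-++ u us vs)

  arcsFrom-++ : ∀ (s : V) us vs → arcsFrom s (us ++ vs) ≡ arcsFrom s us ++ arcsFrom (lastV s us) vs
  arcsFrom-++ s []       vs = refl
  arcsFrom-++ s (u ∷ us) vs = cong ((s , u) ∷_) (arcsFrom-++ u us vs)

  linked-++ : ∀ (s : V) us vs → Linked (Arc m) (s ∷ us) → Linked (Arc m) (lastV s us ∷ vs) →
              Linked (Arc m) (s ∷ us ++ vs)
  linked-++ s []       vs _         l = l
  linked-++ s (u ∷ us) vs (a ∷ lus) l = a ∷ linked-++ u us vs lus l

  linked-++⁻ : ∀ (s : V) us vs → Linked (Arc m) (s ∷ us ++ vs) →
               Linked (Arc m) (s ∷ us) × Linked (Arc m) (lastV s us ∷ vs)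
  linked-++⁻ s []       vs l       = [-] , l
  linked-++⁻ s (u ∷ us) vs (a ∷ l) with linked-++⁻ u us vs l
  ... | lus , lvs = a ∷ lus , lvs

  sources-arcsFrom : ∀ (s : V) vs → map proj₁ (arcsFrom s vs) ≡ initV s vs
  sources-arcsFrom s []       = refl
  sources-arcsFrom s (v ∷ vs) = cong (s ∷_) (sources-arcsFrom v vs)

  length-arcsFrom : ∀ (s : V) vs → length (arcsFrom s vs) ≡ length vs
  length-arcsFrom s []       = refl
  length-arcsFrom s (v ∷ vs) = cong suc (length-arcsFrom v vs)

  snoc-lastV : ∀ (s : V) vs → s ∷ vs ≡ initV s vs ∷ʳ lastV s vs
  snoc-lastV s []       = refl
  snoc-lastV s (v ∷ vs) = cong (s ∷_) (snoc-lastV v vs)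

  srcAndInternal⊆verts : ∀ (P : Walk m) {v} → v ∈ srcAndInternal P → v ∈ verts P
  srcAndInternal⊆verts (s ▸ vs) v∈ = subst (_ ∈_) (sym (snoc-lastV s vs)) (∈-++⁺ˡ v∈)

  srcAndInternal-cases : ∀ (P : Walk m) {v} → v ∈ srcAndInternal P → v ≡ start P ⊎ v ∈ internal P
  srcAndInternal-cases (s ▸ (w ∷ ws)) (here refl) = inj₁ refl
  srcAndInternal-cases (s ▸ (w ∷ ws)) (there v∈) = inj₂ v∈

  srcAndInternal-⊙ : ∀ (P P′ : Walk m) → start P′ ≡ term P →
                     srcAndInternal (P ⊙ P′) ≡ srcAndInternal P ++ srcAndInternal P′
  srcAndInternal-⊙ (s ▸ vs) (s′ ▸ vs′) join =
    trans (initV-++ s vs vs′) (cong (λ a → initV s vs ++ initV a vs′) (sym join))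

  arc-source : ∀ (P : Walk m) {a} → a ∈ arcs P → proj₁ a ∈ srcAndInternal P
  arc-source (s ▸ vs) a∈ = subst (_ ∈_) (sources-arcsFrom s vs) (∈-map⁺ proj₁ a∈)

  arcs-unique : ∀ (P : Walk m) → Unique (srcAndInternal P) → Unique (arcs P)
  arcs-unique (s ▸ vs) u = Unique.map⁻ (subst Unique (sym (sources-arcsFrom s vs)) u)

  arc-of-linked : ∀ (P : Walk m) {a} → Linked (Arc m) (verts P) → a ∈ arcs P → Arc m (proj₁ a) (proj₂ a)
  arc-of-linked (s ▸ (v ∷ vs)) (a ∷ _) (here refl) = a
  arc-of-linked (s ▸ (v ∷ vs)) (_ ∷ l) (there a∈) = arc-of-linked (v ▸ vs) l a∈

  rotW : ℕ → Walk m → Walk m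
  rotW r (s ▸ vs) = rot r s ▸ map (rot r) vs

  srcAndInternal-rotW : ∀ r P → srcAndInternal (rotW r P) ≡ map (rot r) (srcAndInternal P)
  srcAndInternal-rotW r (s ▸ vs) = initV-map (rot r) s vs

  arcs-rotW : ∀ r P → arcs (rotW r P) ≡ map (rot² r) (arcs P)
  arcs-rotW r (s ▸ vs) = arcsFrom-map (rot r) s vs

  term-rotW : ∀ r P → term (rotW r P) ≡ rot r (term P)
  term-rotW r (s ▸ vs) = lastV-map (rot r) s vs

  len-rotW : ∀ r P → len (rotW r P) ≡ len P
  len-rotW r (s ▸ vs) = length-map (rot r) vs

  linked-rotW : ∀ r P → Linked (Arc m) (verts P) → Linked (Arc m) (verts (rotW r P))
  linked-rotW r (s ▸ vs) l = Linked.map⁺ (Linked.map (rot-arc r) l)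

  -- A dipath, except that its last vertex may repeat an earlier one.
  IsPiece : Walk m → Set
  IsPiece P = Linked (Arc m) (verts P) × Unique (srcAndInternal P)

  rotW-piece : ∀ r {P} → IsPiece P → IsPiece (rotW r P)
  rotW-piece r {P} (l , u) = linked-rotW r P l
    , subst Unique (sym (srcAndInternal-rotW r P)) (Unique.map⁺ rot-injective u)

  dipath⇒piece : ∀ {P} → IsDipath m P → IsPiece P
  dipath⇒piece {s ▸ vs} (l , u) =
    l , unique-++ˡ (initV s vs) (subst Unique (snoc-lastV s vs) u)

  data Chain : V → V → List (Walk m) → Set where
    []  : ∀ {a} → Chain a a []
    _∷_ : ∀ {a b P Ps} → start P ≡ a → Chain (term P) b Ps → Chain a b (P ∷ Ps)

  chain-start : ∀ {a a′ b Ps} → a ≡ a′ → Chain a′ b Ps → Chain a b Ps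
  chain-start refl c = c

  chain-end : ∀ {a b b′ Ps} → Chain a b Ps → b ≡ b′ → Chain a b′ Ps
  chain-end c refl = c

  chain-++ : ∀ {a b c Ps Qs} → Chain a b Ps → Chain b c Qs → Chain a c (Ps ++ Qs)
  chain-++ []         Q = Q
  chain-++ (s≡a ∷ P) Q = s≡a ∷ chain-++ P Q

  chain-lastV : ∀ {a b Ps} → Chain a b Ps → lastV a (concatMap rest Ps) ≡ b
  chain-lastV []                       = refl
  chain-lastV {Ps = P ∷ _} (refl ∷ Ps) =
    trans (lastV-++ (start P) (rest P) _) (chain-lastV Ps)

  chain-initV : ∀ {a b Ps} → Chain a b Ps → initV a (concatMap rest Ps) ≡ concatMap srcAndInternal Ps
  chain-initV []                       = refl
  chain-initV {Ps = P ∷ _} (refl ∷ Ps) =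
    trans (initV-++ (start P) (rest P) _) (cong (srcAndInternal P ++_) (chain-initV Ps))

  chain-arcs : ∀ {a b Ps} → Chain a b Ps → arcsFrom a (concatMap rest Ps) ≡ concatMap arcs Ps
  chain-arcs []                       = refl
  chain-arcs {Ps = P ∷ _} (refl ∷ Ps) =
    trans (arcsFrom-++ (start P) (rest P) _) (cong (arcs P ++_) (chain-arcs Ps))

  chain-linked : ∀ {a b Ps} → Chain a b Ps → All (Linked (Arc m) ∘ verts) Ps →
                 Linked (Arc m) (a ∷ concatMap rest Ps)
  chain-linked []                 []          = [-]
  chain-linked {Ps = P ∷ _} (refl ∷ Ps) (lP ∷ lPs) =
    linked-++ (start P) (rest P) _ lP (chain-linked Ps lPs)

  closed-rest↭srcAndInternal : ∀ (P : Walk m) → term P ≡ start P → rest P ↭ srcAndInternal P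
  closed-rest↭srcAndInternal (s ▸ vs) closed = drop-∷
    (subst (_↭ s ∷ initV s vs) (sym (trans (snoc-lastV s vs) (cong (initV s vs ∷ʳ_) closed)))
           (↭-sym (∷↭∷ʳ s (initV s vs))))

  cycle-halves : ∀ (P P′ : Walk m) → IsDirCycle m (P ⊙ P′) → start P′ ≡ term P →
                 IsPiece P × IsPiece P′ × Disjoint (srcAndInternal P) (srcAndInternal P′) ×
                 (∀ {v} → v ∈ srcAndInternal P ++ srcAndInternal P′ → v ∈ rest (P ⊙ P′))
  cycle-halves P P′ (linked , closed , unique-rest , _) join =
    (lP , unique-++ˡ (srcAndInternal P) u)
    , (subst (λ a → Linked (Arc m) (a ∷ rest P′)) (sym join) lP′ , unique-++ʳ (srcAndInternal P) u)
    , unique-++⇒disjoint (srcAndInternal P) u , λ v∈ → ∈-resp-↭ (↭-sym rest↭) (subst (_ ∈_) (sym halves) v∈)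
    where
    halves = srcAndInternal-⊙ P P′ join
    rest↭ = closed-rest↭srcAndInternal (P ⊙ P′) closed
    u = subst Unique halves (unique-resp-↭ rest↭ unique-rest)
    lP  = proj₁ (linked-++⁻ (start P) (rest P) (rest P′) linked)
    lP′ = proj₂ (linked-++⁻ (start P) (rest P) (rest P′) linked)

  cycle-piece : ∀ (P : Walk m) → IsDirCycle m P → IsPiece P × (∀ {v} → v ∈ srcAndInternal P → v ∈ rest P)
  cycle-piece P (linked , closed , unique-rest , _) =
    (linked , unique-resp-↭ rest↭ unique-rest) , ∈-resp-↭ (↭-sym rest↭)
    where rest↭ = closed-rest↭srcAndInternal P closed

  onSide : Side → Fin m → V
  onSide s a = s , a

  allVertices : List V
  allVertices = map (onSide x) (allFin m) ++ map (onSide y) (allFin m)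

  ∈-allVertices : ∀ v → v ∈ allVertices
  ∈-allVertices (x , a) = ∈-++⁺ˡ (∈-map⁺ (onSide x) (∈-allFin a))
  ∈-allVertices (y , a) = ∈-++⁺ʳ (map (onSide x) (allFin m)) (∈-map⁺ (onSide y) (∈-allFin a))

  length-allVertices : length allVertices ≡ m + m
  length-allVertices = trans (length-++ (map (onSide x) (allFin m)))
    (cong₂ _+_ (length-side x) (length-side y))
    where
    length-side : ∀ s → length (map (onSide s) (allFin m)) ≡ m
    length-side s = trans (length-map (onSide s) (allFin m)) (length-tabulate {n = m} λ i → i)

  other : Side → Side
  other x = y
  other y = x

  outArcs : V → List (V × V)
  outArcs u@(s , a) =
    (u , (x , (toℕ a + 1) mod m)) ∷ (u , (y , (toℕ a + 1) mod m)) ∷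
    (u , (x , (toℕ a + 3) mod m)) ∷ (u , (y , (toℕ a + 3) mod m)) ∷ (u , (other s , a)) ∷ []

  private
    head-mod : ∀ {a b : Fin m} d → ModEq m (toℕ a + d) (toℕ b) → b ≡ (toℕ a + d) mod m
    head-mod {a} {b} d e = toℕ-injective (sym (trans (toℕ-fromℕ< _)
      (trans (modEq⇒≈ e) (m<n⇒m%n≡m (toℕ<n b)))))

    other-≢ : ∀ {s t} → s ≢ t → t ≡ other s
    other-≢ {x} {x} s≢t = ⊥-elim (s≢t refl)
    other-≢ {x} {y} _   = refl
    other-≢ {y} {x} _   = refl
    other-≢ {y} {y} s≢t = ⊥-elim (s≢t refl)

  outArcs-complete : ∀ {u v} → Arc m u v → (u , v) ∈ outArcs u
  outArcs-complete {s , a} {t , b} (_ , inj₁ (_ , a≡b , s≢t))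
    rewrite toℕ-injective a≡b | other-≢ s≢t = there (there (there (there (here refl))))
  outArcs-complete {s , a} {x , b} (_ , inj₂ (inj₁ refl , e)) rewrite head-mod 1 e = here refl
  outArcs-complete {s , a} {y , b} (_ , inj₂ (inj₁ refl , e)) rewrite head-mod 1 e = there (here refl)
  outArcs-complete {s , a} {x , b} (_ , inj₂ (inj₂ refl , e)) rewrite head-mod 3 e = there (there (here refl))
  outArcs-complete {s , a} {y , b} (_ , inj₂ (inj₂ refl , e)) rewrite head-mod 3 e = there (there (there (here refl)))

  allArcs : List (V × V)
  allArcs = concatMap outArcs allVertices

  ∈-allArcs : ∀ {u v} → Arc m u v → (u , v) ∈ allArcs
  ∈-allArcs {u} uv = ∈-concatMap⁺ outArcs (Any.map (λ { refl → outArcs-complete uv }) (∈-allVertices u))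

  length-allArcs : length allArcs ≡ (m + m) * 5
  length-allArcs = trans (length-concatMap allVertices (λ {u} _ → length-outArcs u))
                         (cong (_* 5) length-allVertices)
    where
    length-outArcs : ∀ u → length (outArcs u) ≡ 5
    length-outArcs (_ , _) = refl


module BasicSets (p k : ℕ) .{{_ : NonZero (p + 12 * k)}} where

  m : ℕ
  m = p + 12 * k

  open Graph m

  -- Long walks lie in layer 0 and the copy ρ^{12j}(S) of a short walk S in layer j+1.
  InLayer : ℕ → ℕ → Set
  InLayer zero    t = t < p
  InLayer (suc j) t = p + 12 * j ≤ t × t < p + 12 * suc j

  inLayer-unique : ∀ {i j t} → InLayer i t → InLayer j t → i ≡ j
  inLayer-unique {zero}  {zero}  _ _ = refl
  inLayer-unique {zero}  {suc j} t<p (p+12j≤t , _) = ⊥-elim (<⇒≱ t<p (≤-trans (m≤m+n p _) p+12j≤t))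
  inLayer-unique {suc i} {zero}  (p+12i≤t , _) t<p = ⊥-elim (<⇒≱ t<p (≤-trans (m≤m+n p _) p+12i≤t))
  inLayer-unique {suc i} {suc j} (lo-i , hi-i) (lo-j , hi-j) =
    cong suc (≤-antisym (below lo-i hi-j) (below lo-j hi-i))
    where
    below : ∀ {a b t} → p + 12 * a ≤ t → t < p + 12 * suc b → a ≤ b
    below {a} {b} lo hi = m<1+n⇒m≤n (*-cancelˡ-< 12 a (suc b) (+-cancelˡ-< p _ _ (≤-<-trans lo hi)))

  WalkInLayer : ℕ → Walk m → Set
  WalkInLayer j P = ∀ {v} → v ∈ srcAndInternal P → InLayer j (idx v)

  Apart : Walk m → Walk m → Set
  Apart P Q = Disjoint (srcAndInternal P) (srcAndInternal Q)

  apart-sym : ∀ {P Q} → Apart P Q → Apart Q P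
  apart-sym P#Q (v∈Q , v∈P) = P#Q (v∈P , v∈Q)

  layers-apart : ∀ {i j P Q} → WalkInLayer i P → WalkInLayer j Q → i ≢ j → Apart P Q
  layers-apart P∈i Q∈j i≢j (v∈P , v∈Q) = i≢j (inLayer-unique (P∈i v∈P) (Q∈j v∈Q))

  LongWalk ShortWalk : Walk m → Set
  LongWalk  P = IsPiece P × WalkInLayer 0 P
  ShortWalk P = IsPiece P × WalkInLayer 1 P

  copy-inLayer : ∀ {S j} → WalkInLayer 1 S → j < k → WalkInLayer (suc j) (rotW (12 * j) S)
  copy-inLayer {S} {j} S∈1 j<k v∈ with ∈-map⁻ (rot (12 * j)) (subst (_ ∈_) (srcAndInternal-rotW (12 * j) S) v∈)
  ... | w , w∈ , refl with S∈1 w∈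
  ... | p≤w , w<p+12 = subst (InLayer (suc j)) (sym (idx-rot-small (12 * j) w (<-≤-trans hi top)))
                         (+-monoˡ-≤ (12 * j) (subst (_≤ idx w) (+-identityʳ p) p≤w) , hi)
    where
    p+12[1+j] : p + 12 + 12 * j ≡ p + 12 * suc j
    p+12[1+j] = trans (+-assoc p 12 (12 * j)) (cong (p +_) (sym (*-suc 12 j)))
    hi : idx w + 12 * j < p + 12 * suc j
    hi = subst (idx w + 12 * j <_) p+12[1+j] (+-monoˡ-< (12 * j) w<p+12)
    top : p + 12 * suc j ≤ m
    top = +-monoʳ-≤ p (*-monoʳ-≤ 12 j<k)

  -- Since p + 12k = m, the rotation by 12k undoes ρ^p.
  rot-12k-rhoInv : ∀ {u v} → IsRhoInvP m p u v → rot (12 * k) v ≡ u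
  rot-12k-rhoInv {u} {v} (su≡sv , u+p≡v) = trans (rot-≡ {v} {u} {12 * k} {0} (sym su≡sv) (begin
    (idx v + 12 * k) % m      ≡⟨ ≈-+ʳ (12 * k) (sym (modEq⇒≈ u+p≡v)) ⟩
    (idx u + p + 12 * k) % m  ≡⟨ cong (_% m) (+-assoc (idx u) p (12 * k)) ⟩
    (idx u + m) % m           ≡⟨ +m≈ (idx u) ⟩
    idx u % m                 ≡⟨ cong (_% m) (sym (+-identityʳ (idx u))) ⟩
    (idx u + 0) % m           ∎)) (rot-zero u)
    where open ≡-Reasoning

  record Segment (L S L′ : Walk m) : Set where
    field
      attach : 1 ≤ k → start S ≡ term L × rot 12 (start S) ≡ term S
      next   : IsRhoInvP m p (start L′) (term L)

  Linking : Walk m → List (Walk m × Walk m) → Set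
  Linking L₀ []                          = ⊤
  Linking L₀ ((L , S) ∷ [])              = Segment L S L₀
  Linking L₀ ((L , S) ∷ (L′ , S′) ∷ σs) = Segment L S L′ × Linking L₀ ((L′ , S′) ∷ σs)

  record CycleOK (c : List⁺ (Walk m × Walk m)) : Set where
    field
      linking      : Linking (proj₁ (head c)) (toList c)
      long-length  : sum (map (len ∘ proj₁) (toList c)) ≡ p
      short-length : 1 ≤ k → sum (map (len ∘ proj₂) (toList c)) ≡ 12

  segmentsOf : List (List⁺ (Walk m × Walk m)) → List (Walk m × Walk m)
  segmentsOf = concatMap toList

  record FactorOK (F : List (List⁺ (Walk m × Walk m))) : Set where
    field
      cycles      : All CycleOK F
      longs       : All LongWalk (map proj₁ (segmentsOf F))
      longsApart  : AllPairs Apart (map proj₁ (segmentsOf F))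
      shorts      : 1 ≤ k → All ShortWalk (map proj₂ (segmentsOf F))
      shortsApart : 1 ≤ k → AllPairs Apart (map proj₂ (segmentsOf F))

  twelve-step : ∀ {S : Walk m} → C6 m p S → rot 12 (start S) ≡ term S
  twelve-step {S} (side-eq , t≡s+12 , _) = trans
    (rot-≡ {start S} {term S} {12} {0} (sym side-eq)
           (trans (sym (modEq⇒≈ t≡s+12)) (cong (_% m) (sym (+-identityʳ _)))))
    (rot-zero (term S))

  segment : ∀ {L S L′ : Walk m} → term L ≡ src S → (1 ≤ k → C6 m p S) → IsRhoInvP m p (src L′) (term L) →
            Segment L S L′
  segment {S = S} tL≡sS c6 ρ = record { attach = λ k≥1 → sym tL≡sS , twelve-step {S} (c6 k≥1) ; next = ρ }

  long-layer : ∀ {L : Walk m} → C4 m p L → WalkInLayer 0 L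
  long-layer (L<p , _) = L<p

  short-walk : ∀ {L S : Walk m} → 1 ≤ k → C4 m p L → term L ≡ src S → C6 m p S → IsDipath m S → ShortWalk S
  short-walk {L} {S} k≥1 (_ , j , j<3 , tL≈p+j) tL≡sS (_ , _ , internal∈1) S-dipath =
    dipath⇒piece S-dipath , λ v∈ → in-layer (srcAndInternal-cases S v∈)
    where
    3≤12 : 3 ≤ 12
    3≤12 = s≤s (s≤s (s≤s z≤n))
    p+j<m : p + j < m
    p+j<m = <-≤-trans (+-monoʳ-< p j<3) (+-monoʳ-≤ p (≤-trans 3≤12 (*-monoʳ-≤ 12 k≥1)))
    in-layer : ∀ {v} → v ≡ start S ⊎ v ∈ internal S → InLayer 1 (idx v)
    in-layer (inj₁ refl) = subst (InLayer 1) (sym (trans (cong idx (sym tL≡sS))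
                             (≈⇒≡ (idx<m (term L)) p+j<m (modEq⇒≈ tL≈p+j))))
                             (subst (_≤ p + j) (sym (+-identityʳ p)) (m≤m+n p j)
                             , +-monoʳ-< p (<-≤-trans j<3 3≤12))
    in-layer {v} (inj₂ v∈) with internal∈1 v∈
    ... | p≤v , v<p+12 = subst (_≤ idx v) (sym (+-identityʳ p)) p≤v , v<p+12

  join-if-k≡0 : k ≡ 0 → ∀ {u v} → IsRhoInvP m p u v → u ≡ v
  join-if-k≡0 k≡0 {u} {v} ρ =
    trans (sym (rot-12k-rhoInv ρ)) (trans (cong (λ n → rot (12 * n) v) k≡0) (rot-zero v))

  disj⇒apart : ∀ {P Q : Walk m} → Disj P Q → Apart P Q
  disj⇒apart {P} {Q} P#Q (v∈P , v∈Q) = P#Q (srcAndInternal⊆verts P v∈P) (srcAndInternal⊆verts Q v∈Q)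

  halves-apart : ∀ {P P′ Q Q′ : Walk m} {xs ys} →
                 (∀ {v} → v ∈ srcAndInternal P ++ srcAndInternal P′ → v ∈ xs) →
                 (∀ {v} → v ∈ srcAndInternal Q ++ srcAndInternal Q′ → v ∈ ys) → VDisjoint xs ys →
                 Apart P Q × Apart P Q′ × Apart P′ Q × Apart P′ Q′
  halves-apart {P} {P′} {Q} {Q′} PP′⊆xs QQ′⊆ys xs#ys =
      (λ (v∈P  , v∈Q)  → xs#ys (PP′⊆xs (∈-++⁺ˡ v∈P)) (QQ′⊆ys (∈-++⁺ˡ v∈Q)))
    , (λ (v∈P  , v∈Q′) → xs#ys (PP′⊆xs (∈-++⁺ˡ v∈P)) (QQ′⊆ys (∈-++⁺ʳ (srcAndInternal Q) v∈Q′)))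
    , (λ (v∈P′ , v∈Q)  → xs#ys (PP′⊆xs (∈-++⁺ʳ (srcAndInternal P) v∈P′)) (QQ′⊆ys (∈-++⁺ˡ v∈Q)))
    , (λ (v∈P′ , v∈Q′) → xs#ys (PP′⊆xs (∈-++⁺ʳ (srcAndInternal P) v∈P′)) (QQ′⊆ys (∈-++⁺ʳ (srcAndInternal Q) v∈Q′)))

  private
    pair-sum : ∀ {a b n} → a + b ≡ n → a + (b + 0) ≡ n
    pair-sum {a} {b} e = trans (cong (a +_) (+-identityʳ b)) e

    singleton-sum : ∀ {a n} → a ≡ n → a + 0 ≡ n
    singleton-sum {a} e = trans (+-identityʳ a) e

  module Type2 (B : Type2Basic p k) where
    open Type2Basic B hiding (m)

    factor : List (List⁺ (Walk m × Walk m))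
    factor = ((W , Q) ∷ (X , R) ∷ []) ∷ ((Y , S) ∷ (Z , T) ∷ []) ∷ []

    longPieces : k ≡ 0 ⊎ 1 ≤ k →
                 All IsPiece (W ∷ X ∷ Y ∷ Z ∷ []) × AllPairs Apart (W ∷ X ∷ Y ∷ Z ∷ [])
    longPieces (inj₁ k≡0) =
      let (cycWX , cycYZ , WX#YZ) = C1-zero k≡0
          (ρXW , _ , ρZY , _) = C2
          (pW , pX , W#X , WX⊆) = cycle-halves W X (proj₁ cycWX) (join-if-k≡0 k≡0 ρXW)
          (pY , pZ , Y#Z , YZ⊆) = cycle-halves Y Z (proj₁ cycYZ) (join-if-k≡0 k≡0 ρZY)
          (W#Y , W#Z , X#Y , X#Z) = halves-apart WX⊆ YZ⊆ WX#YZ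
      in  pW ∷ pX ∷ pY ∷ pZ ∷ []
        , (W#X ∷ W#Y ∷ W#Z ∷ []) ∷ (X#Y ∷ X#Z ∷ []) ∷ (Y#Z ∷ []) ∷ [] ∷ []
    longPieces (inj₂ k≥1) =
      let (dW , dX , dY , dZ , _) = dipaths
          (W#X , W#Y , W#Z , X#Y , X#Z , Y#Z) = C1-pos k≥1
      in  dipath⇒piece dW ∷ dipath⇒piece dX ∷ dipath⇒piece dY ∷ dipath⇒piece dZ ∷ []
        , (disj⇒apart W#X ∷ disj⇒apart W#Y ∷ disj⇒apart W#Z ∷ [])
        ∷ (disj⇒apart X#Y ∷ disj⇒apart X#Z ∷ []) ∷ (disj⇒apart Y#Z ∷ []) ∷ [] ∷ []

    factorOK : k ≡ 0 ⊎ 1 ≤ k → FactorOK factor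
    factorOK k≡0∨k≥1 =
      let (c4W , c4X , c4Y , c4Z) = C4s
          (tW≡sQ , tX≡sR , tY≡sS , tZ≡sT) = C5
          (ρXW , ρWX , ρZY , ρYZ) = C2
          (lW+lX , lY+lZ) = C3
          (pieces , apart) = longPieces k≡0∨k≥1
      in record
      { cycles = record { linking = segment tW≡sQ (proj₁ ∘ C6s) ρXW , segment tX≡sR (proj₁ ∘ proj₂ ∘ C6s) ρWX
                        ; long-length = pair-sum {len W} lW+lX ; short-length = pair-sum {len Q} ∘ proj₁ ∘ C3-pos }
               ∷ record { linking = segment tY≡sS (proj₁ ∘ proj₂ ∘ proj₂ ∘ C6s) ρZY
                                  , segment tZ≡sT (proj₂ ∘ proj₂ ∘ proj₂ ∘ C6s) ρYZ
                        ; long-length = pair-sum {len Y} lY+lZ ; short-length = pair-sum {len S} ∘ proj₂ ∘ C3-pos }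
               ∷ []
      ; longs = All.zip {Q = WalkInLayer 0} (pieces , long-layer c4W ∷ long-layer c4X ∷ long-layer c4Y ∷ long-layer c4Z ∷ [])
      ; longsApart = apart
      ; shorts = λ k≥1 →
          let (_ , _ , _ , _ , dQ , dR , dS , dT) = dipaths
              (c6Q , c6R , c6S , c6T) = C6s k≥1
          in  short-walk k≥1 c4W tW≡sQ c6Q dQ ∷ short-walk k≥1 c4X tX≡sR c6R dR
            ∷ short-walk k≥1 c4Y tY≡sS c6S dS ∷ short-walk k≥1 c4Z tZ≡sT c6T dT ∷ []
      ; shortsApart = λ _ →
          let (Q#R , Q#S , Q#T , R#S , R#T , S#T) = C1-QRST
          in  (disj⇒apart Q#R ∷ disj⇒apart Q#S ∷ disj⇒apart Q#T ∷ [])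
            ∷ (disj⇒apart R#S ∷ disj⇒apart R#T ∷ []) ∷ (disj⇒apart S#T ∷ []) ∷ [] ∷ []
      }

  module Type1 (B : Type1Basic p k) where
    open Type1Basic B hiding (m)

    factor : List (List⁺ (Walk m × Walk m))
    factor = ((X , R) ∷ []) ∷ ((Y , S) ∷ []) ∷ []

    longPieces : k ≡ 0 ⊎ 1 ≤ k → All IsPiece (X ∷ Y ∷ []) × AllPairs Apart (X ∷ Y ∷ [])
    longPieces (inj₁ k≡0) =
      let (cycX , cycY , X#Y) = C1-zero k≡0
          (pX , X⊆) = cycle-piece X (proj₁ cycX)
          (pY , Y⊆) = cycle-piece Y (proj₁ cycY)
      in  pX ∷ pY ∷ [] , ((λ (v∈X , v∈Y) → X#Y (X⊆ v∈X) (Y⊆ v∈Y)) ∷ []) ∷ [] ∷ []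
    longPieces (inj₂ k≥1) =
      let (dX , dY , X#Y) = C1-pos k≥1
      in  dipath⇒piece dX ∷ dipath⇒piece dY ∷ [] , (disj⇒apart X#Y ∷ []) ∷ [] ∷ []

    factorOK : k ≡ 0 ⊎ 1 ≤ k → FactorOK factor
    factorOK k≡0∨k≥1 =
      let (c4X , c4Y) = C4s
          (tX≡sR , tY≡sS) = C5
          (ρX , ρY) = C2
          (lX , lY) = C3
          (pieces , apart) = longPieces k≡0∨k≥1
      in record
      { cycles = record { linking = segment tX≡sR (proj₁ ∘ C6s) ρX
                        ; long-length = singleton-sum lX ; short-length = singleton-sum ∘ proj₁ ∘ C3-pos }
               ∷ record { linking = segment tY≡sS (proj₂ ∘ C6s) ρY
                        ; long-length = singleton-sum lY ; short-length = singleton-sum ∘ proj₂ ∘ C3-pos }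
               ∷ []
      ; longs = All.zip {Q = WalkInLayer 0} (pieces , long-layer c4X ∷ long-layer c4Y ∷ [])
      ; longsApart = apart
      ; shorts = λ k≥1 →
          let (dR , dS , _) = C1-RS
              (c6R , c6S) = C6s k≥1
          in  short-walk k≥1 c4X tX≡sR c6R dR ∷ short-walk k≥1 c4Y tY≡sS c6S dS ∷ []
      ; shortsApart = λ _ → (disj⇒apart (proj₂ (proj₂ C1-RS)) ∷ []) ∷ [] ∷ []
      }


module Factorization (p k : ℕ) .{{_ : NonZero (p + 12 * k)}} {I : Set} (g : I → Walk (p + 12 * k)) where

  open BasicSets p k
  open Graph m

  data Kind : Set where
    long short : Kind

  -- A long walk is used once; the short walk S of a segment is used k times, as ρ^{12j}(S) for j < k.
  data Piece : Set where
    longPiece : I → Piece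
    shortCopy : I → ℕ → Piece

  walkOf : Piece → Walk m
  walkOf (longPiece i)   = g i
  walkOf (shortCopy i j) = rotW (12 * j) (g i)

  copies : I → ℕ → ℕ → List Piece
  copies i j zero    = []
  copies i j (suc n) = shortCopy i j ∷ copies i (suc j) n

  block : I × Kind → List Piece
  block (i , long)  = longPiece i ∷ []
  block (i , short) = copies i 0 k

  kinded : List (I × I) → List (I × Kind)
  kinded = concatMap λ (l , s) → (l , long) ∷ (s , short) ∷ []

  indices : List (I × I) → List I
  indices σs = map proj₁ (kinded σs)

  piecesOf : List (I × I) → List Piece
  piecesOf σs = concatMap block (kinded σs)

  onWalks : List⁺ (I × I) → List⁺ (Walk m × Walk m)
  onWalks = List⁺.map (Product.map g g)

  cycleWalk : List⁺ (I × I) → Walk m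
  cycleWalk c = start (g (proj₁ (head c))) ▸ concatMap rest (map walkOf (piecesOf (toList c)))

  copies-chain : ∀ {i} → rot 12 (start (g i)) ≡ term (g i) → ∀ j n →
                 Chain (rot (12 * j) (start (g i))) (rot (12 * (j + n)) (start (g i))) (map walkOf (copies i j n))
  copies-chain {i} _ j zero = chain-end [] (cong (λ n → rot (12 * n) (start (g i))) (sym (+-identityʳ j)))
  copies-chain {i} twist j (suc n) = refl ∷ chain-start step
    (chain-end (copies-chain twist (suc j) n) (cong (λ n → rot (12 * n) (start (g i))) (sym (+-suc j n))))
    where
    step : term (rotW (12 * j) (g i)) ≡ rot (12 * suc j) (start (g i))
    step = begin
      term (rotW (12 * j) (g i))            ≡⟨ term-rotW (12 * j) (g i) ⟩
      rot (12 * j) (term (g i))             ≡⟨ cong (rot (12 * j)) (sym twist) ⟩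
      rot (12 * j) (rot 12 (start (g i)))   ≡⟨ rot-rot (12 * j) 12 (start (g i)) ⟩
      rot (12 + 12 * j) (start (g i))       ≡⟨ cong (λ r → rot r (start (g i))) (sym (*-suc 12 j)) ⟩
      rot (12 * suc j) (start (g i))        ∎
      where open ≡-Reasoning

  segment-copies-chain : ∀ {a} s n → (1 ≤ n → start (g s) ≡ a × rot 12 (start (g s)) ≡ term (g s)) →
                Chain a (rot (12 * n) a) (map walkOf (copies s 0 n))
  segment-copies-chain {a} s zero    _      = chain-end [] (sym (rot-zero a))
  segment-copies-chain {a} s (suc n) attach with attach (s≤s z≤n)
  ... | refl , twist = chain-start (sym (rot-zero a)) (copies-chain twist 0 (suc n))

  segment-chain : ∀ {l s L′} → Segment (g l) (g s) L′ →
                  Chain (start (g l)) (start L′) (map walkOf (longPiece l ∷ copies s 0 k))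
  segment-chain {l} {s} seg = refl ∷ chain-end (segment-copies-chain s k (Segment.attach seg))
                                                (rot-12k-rhoInv (Segment.next seg))

  private
    chain-++-map : ∀ {a b c} ds es → Chain a b (map walkOf ds) → Chain b c (map walkOf es) →
                   Chain a c (map walkOf (ds ++ es))
    chain-++-map ds es cd ce = subst (Chain _ _) (sym (map-++ walkOf ds es)) (chain-++ cd ce)

  cycle-chain : ∀ l₀ l s σs → Linking (g l₀) (map (Product.map g g) ((l , s) ∷ σs)) →
                Chain (start (g l)) (start (g l₀)) (map walkOf (piecesOf ((l , s) ∷ σs)))
  cycle-chain l₀ l s []                 seg         =
    chain-++-map (longPiece l ∷ copies s 0 k) [] (segment-chain seg) []
  cycle-chain l₀ l s ((l′ , s′) ∷ σs) (seg , more) =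
    chain-++-map (longPiece l ∷ copies s 0 k) (piecesOf ((l′ , s′) ∷ σs)) (segment-chain seg)
                 (cycle-chain l₀ l′ s′ σs more)

  private
    length-rests : ∀ (ds es : List Piece) → length (concatMap rest (map walkOf (ds ++ es))) ≡
                   length (concatMap rest (map walkOf ds)) + length (concatMap rest (map walkOf es))
    length-rests ds es = trans (cong (length ∘ concatMap rest) (map-++ walkOf ds es))
      (trans (cong length (concatMap-++ rest (map walkOf ds) (map walkOf es))) (length-++ (concatMap rest (map walkOf ds))))

  length-copies : ∀ i j n → length (concatMap rest (map walkOf (copies i j n))) ≡ n * len (g i)
  length-copies i j zero    = refl
  length-copies i j (suc n) = trans (length-++ (rest (rotW (12 * j) (g i))))
    (cong₂ _+_ (len-rotW (12 * j) (g i)) (length-copies i (suc j) n))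

  length-pieces : ∀ σs → length (concatMap rest (map walkOf (piecesOf σs))) ≡
                  sum (map (len ∘ proj₁) (map (Product.map g g) σs)) + k * sum (map (len ∘ proj₂) (map (Product.map g g) σs))
  length-pieces []             = sym (*-zeroʳ k)
  length-pieces ((l , s) ∷ σs) = begin
    length (rest (g l) ++ concatMap rest (map walkOf (copies s 0 k ++ piecesOf σs)))
      ≡⟨ length-++ (rest (g l)) ⟩
    len (g l) + length (concatMap rest (map walkOf (copies s 0 k ++ piecesOf σs)))
      ≡⟨ cong (len (g l) +_) (length-rests (copies s 0 k) (piecesOf σs)) ⟩
    len (g l) + (length (concatMap rest (map walkOf (copies s 0 k))) + length (concatMap rest (map walkOf (piecesOf σs))))
      ≡⟨ cong₂ (λ a b → len (g l) + (a + b)) (length-copies s 0 k) (length-pieces σs) ⟩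
    len (g l) + (k * len (g s) + (L + k * S))
      ≡⟨ solve 5 (λ a b k L S → a :+ (k :* b :+ (L :+ k :* S)) := a :+ L :+ k :* (b :+ S)) refl (len (g l)) (len (g s)) k L S ⟩
    len (g l) + L + k * (len (g s) + S)  ∎
    where
    open ≡-Reasoning
    open +-*-Solver using (solve; _:+_; _:*_; _:=_)
    L = sum (map (len ∘ proj₁) (map (Product.map g g) σs))
    S = sum (map (len ∘ proj₂) (map (Product.map g g) σs))

  private
    copies-of-shorts : ∀ n {s} → (1 ≤ n → s ≡ 12) → n * s ≡ 12 * n
    copies-of-shorts zero    _    = refl
    copies-of-shorts (suc n) s≡12 = trans (cong (suc n *_) (s≡12 (s≤s z≤n))) (*-comm (suc n) 12)

  len-cycleWalk : ∀ c → CycleOK (onWalks c) → len (cycleWalk c) ≡ m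
  len-cycleWalk c@((l , s) ∷ σs) ok = trans (length-pieces (toList c))
    (cong₂ _+_ (CycleOK.long-length ok)
      (copies-of-shorts k (CycleOK.short-length ok)))

  keyOf : Piece → I × Kind
  keyOf (longPiece i)   = i , long
  keyOf (shortCopy i _) = i , short

  ∈-copies : ∀ {i j n d} → d ∈ copies i j n → ∃ λ j′ → d ≡ shortCopy i j′ × j ≤ j′ × j′ < j + n
  ∈-copies {j = j} {suc n} (here refl) = j , refl , ≤-refl , subst (j <_) (sym (+-suc j n)) (s≤s (m≤m+n j n))
  ∈-copies {j = j} {suc n} (there d∈) with ∈-copies d∈
  ... | j′ , refl , j<j′ , j′<j+1+n = j′ , refl , ≤-trans (n≤1+n j) j<j′ , subst (j′ <_) (sym (+-suc j n)) j′<j+1+n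

  ∈-block : ∀ {κ d} → d ∈ block κ → keyOf d ≡ κ
  ∈-block {_ , long}  (here refl) = refl
  ∈-block {_ , short} d∈ with ∈-copies d∈
  ... | _ , refl , _ = refl

  Occurs : List (I × I) → Piece → Set
  Occurs σs (longPiece i)   = i ∈ map proj₁ σs
  Occurs σs (shortCopy i j) = i ∈ map proj₂ σs × j < k

  ∈-piecesOf : ∀ σs {d} → d ∈ piecesOf σs → Occurs σs d
  ∈-piecesOf ((l , s) ∷ σs) (here refl) = here refl
  ∈-piecesOf ((l , s) ∷ σs) {d} (there d∈) with ∈-++⁻ (copies s 0 k) d∈
  ... | inj₁ d∈copies with ∈-copies d∈copies
  ...   | j , refl , _ , j<k = here refl , j<k
  ∈-piecesOf ((l , s) ∷ σs) {longPiece i}   (there d∈) | inj₂ d∈more = there (∈-piecesOf σs d∈more)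
  ∈-piecesOf ((l , s) ∷ σs) {shortCopy i j} (there d∈) | inj₂ d∈more =
    Product.map₁ there (∈-piecesOf σs d∈more)

  unique-copies : ∀ i j n → Unique (copies i j n)
  unique-copies i j zero    = []
  unique-copies i j (suc n) = All.tabulate fresh ∷ unique-copies i (suc j) n
    where
    fresh : ∀ {d} → d ∈ copies i (suc j) n → shortCopy i j ≢ d
    fresh d∈ refl with ∈-copies d∈
    ... | _ , refl , j<j , _ = <-irrefl refl j<j

  unique-pieces : ∀ σs → Unique (indices σs) → Unique (piecesOf σs)
  unique-pieces σs u = concatMap-unique (Unique.map⁻ u) unique-block
    (λ _ _ κ≢κ′ (d∈ , d∈′) → κ≢κ′ (trans (sym (∈-block d∈)) (∈-block d∈′)))
    where
    unique-block : ∀ {κ} → κ ∈ kinded σs → Unique (block κ)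
    unique-block {_ , long}  _ = [] ∷ []
    unique-block {i , short} _ = unique-copies i 0 k

  layerOf : Piece → ℕ
  layerOf (longPiece _)   = 0
  layerOf (shortCopy _ j) = suc j

  PieceOK : Piece → Set
  PieceOK d = IsPiece (walkOf d) × WalkInLayer (layerOf d) (walkOf d)

  apart-rotW : ∀ r {P Q} → Apart P Q → Apart (rotW r P) (rotW r Q)
  apart-rotW r {P} {Q} P#Q = subst₂ Disjoint (sym (srcAndInternal-rotW r P)) (sym (srcAndInternal-rotW r Q))
                               (map-disjoint rot-injective P#Q)

  arcs-disjoint-rotW : ∀ r {P Q} → Disjoint (arcs P) (arcs Q) → Disjoint (arcs (rotW r P)) (arcs (rotW r Q))
  arcs-disjoint-rotW r {P} {Q} P#Q = subst₂ Disjoint (sym (arcs-rotW r P)) (sym (arcs-rotW r Q))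
                                       (map-disjoint rot²-injective P#Q)

  apart⇒arcs-disjoint : ∀ {P Q} → Apart P Q → Disjoint (arcs P) (arcs Q)
  apart⇒arcs-disjoint {P} {Q} P#Q (a∈P , a∈Q) = P#Q (arc-source P a∈P , arc-source Q a∈Q)

  private
    suc≢ : ∀ {i j} → i ≢ j → suc i ≢ suc j
    suc≢ i≢j refl = i≢j refl

  -- Two pieces in a common layer are rotations of two walks of the same kind by the same amount.
  pieces-apart : ∀ σs →
    (∀ {i i′} → i ∈ map proj₁ σs → i′ ∈ map proj₁ σs → i ≢ i′ → Apart (g i) (g i′)) →
    (1 ≤ k → ∀ {i i′} → i ∈ map proj₂ σs → i′ ∈ map proj₂ σs → i ≢ i′ → Apart (g i) (g i′)) →
    ∀ {d e} → d ∈ piecesOf σs → e ∈ piecesOf σs → PieceOK d → PieceOK e → d ≢ e → Apart (walkOf d) (walkOf e)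
  pieces-apart σs longs _ {longPiece i} {longPiece i′} d∈ e∈ _ _ d≢e =
    longs (∈-piecesOf σs d∈) (∈-piecesOf σs e∈) (d≢e ∘ cong longPiece)
  pieces-apart σs _ shorts {shortCopy i j} {shortCopy i′ j′} d∈ e∈ (_ , d∈j) (_ , e∈j′) d≢e with j ≟ j′
  ... | no j≢j′  = layers-apart d∈j e∈j′ (suc≢ j≢j′)
  ... | yes refl with ∈-piecesOf σs d∈ | ∈-piecesOf σs e∈
  ...   | i∈ , j<k | i′∈ , _ = apart-rotW (12 * j) (shorts (≤-trans (s≤s z≤n) j<k) i∈ i′∈ λ { refl → d≢e refl })
  pieces-apart _ _ _ {longPiece _}   {shortCopy _ _} _ _ (_ , d∈0) (_ , e∈j) _ = layers-apart d∈0 e∈j λ ()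
  pieces-apart _ _ _ {shortCopy _ _} {longPiece _}   _ _ (_ , d∈j) (_ , e∈0) _ = layers-apart d∈j e∈0 λ ()

  pieces-arcs-disjoint : (∀ {i i′} → i ≢ i′ → Disjoint (arcs (g i)) (arcs (g i′))) →
                         ∀ {d e} → PieceOK d → PieceOK e → d ≢ e → Disjoint (arcs (walkOf d)) (arcs (walkOf e))
  pieces-arcs-disjoint H {longPiece i} {longPiece i′} _ _ d≢e = H (d≢e ∘ cong longPiece)
  pieces-arcs-disjoint H {shortCopy i j} {shortCopy i′ j′} (_ , d∈j) (_ , e∈j′) d≢e with j ≟ j′
  ... | yes refl = arcs-disjoint-rotW (12 * j) (H λ { refl → d≢e refl })
  ... | no j≢j′  = apart⇒arcs-disjoint (layers-apart d∈j e∈j′ (suc≢ j≢j′))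
  pieces-arcs-disjoint H {longPiece _}   {shortCopy _ _} (_ , d∈0) (_ , e∈j) _ =
    apart⇒arcs-disjoint (layers-apart d∈0 e∈j λ ())
  pieces-arcs-disjoint H {shortCopy _ _} {longPiece _}   (_ , d∈j) (_ , e∈0) _ =
    apart⇒arcs-disjoint (layers-apart d∈j e∈0 λ ())

  segments-onWalks : ∀ F → segmentsOf (map onWalks F) ≡ map (Product.map g g) (concatMap toList F)
  segments-onWalks F = trans (concatMap-map toList onWalks F) (sym (map-concatMap (Product.map g g) toList F))

  kinded-concatMap : ∀ {A : Set} (h : A → List (I × I)) xs → kinded (concatMap h xs) ≡ concatMap (kinded ∘ h) xs
  kinded-concatMap h xs = concatMap-concatMap _ h xs

  piecesOf-concatMap : ∀ {A : Set} (h : A → List (I × I)) xs → piecesOf (concatMap h xs) ≡ concatMap (piecesOf ∘ h) xs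
  piecesOf-concatMap h xs = trans (cong (concatMap block) (kinded-concatMap h xs))
                                  (concatMap-concatMap block (kinded ∘ h) xs)

  gather : ∀ {A X : Set} (f : Walk m → List X) (h : A → List (I × I)) xs →
           concatMap (λ x → concatMap f (map walkOf (piecesOf (h x)))) xs ≡ concatMap f (map walkOf (piecesOf (concatMap h xs)))
  gather f h xs = begin
    concatMap (concatMap f ∘ map walkOf ∘ piecesOf ∘ h) xs
      ≡⟨ sym (concatMap-concatMap f (map walkOf ∘ piecesOf ∘ h) xs) ⟩
    concatMap f (concatMap (map walkOf ∘ piecesOf ∘ h) xs)
      ≡⟨ cong (concatMap f) (sym (map-concatMap walkOf (piecesOf ∘ h) xs)) ⟩
    concatMap f (map walkOf (concatMap (piecesOf ∘ h) xs))
      ≡⟨ cong (concatMap f ∘ map walkOf) (sym (piecesOf-concatMap h xs)) ⟩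
    concatMap f (map walkOf (piecesOf (concatMap h xs)))     ∎
    where open ≡-Reasoning

  module Factor (F : List (List⁺ (I × I))) (ok : FactorOK (map onWalks F)) where
    open FactorOK ok

    σs : List (I × I)
    σs = concatMap toList F

    private
      longs≡ : map proj₁ (segmentsOf (map onWalks F)) ≡ map g (map proj₁ σs)
      longs≡ = trans (cong (map proj₁) (segments-onWalks F)) (trans (sym (map-∘ σs)) (map-∘ σs))
      shorts≡ : map proj₂ (segmentsOf (map onWalks F)) ≡ map g (map proj₂ σs)
      shorts≡ = trans (cong (map proj₂) (segments-onWalks F)) (trans (sym (map-∘ σs)) (map-∘ σs))

    piece-ok : ∀ {d} → d ∈ piecesOf σs → PieceOK d
    piece-ok {longPiece i} d∈ =
      All.lookup (subst (All LongWalk) longs≡ longs) (∈-map⁺ g (∈-piecesOf σs d∈))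
    piece-ok {shortCopy i j} d∈ with ∈-piecesOf σs d∈
    ... | i∈ , j<k with All.lookup (subst (All ShortWalk) shorts≡ (shorts (≤-trans (s≤s z≤n) j<k))) (∈-map⁺ g i∈)
    ...   | piece , in-layer-1 = rotW-piece (12 * j) piece , copy-inLayer in-layer-1 j<k

    pieces-vertices-unique : Unique (indices σs) → Unique (concatMap srcAndInternal (map walkOf (piecesOf σs)))
    pieces-vertices-unique u = subst Unique (sym (concatMap-map srcAndInternal walkOf (piecesOf σs)))
      (concatMap-unique (unique-pieces σs u) (proj₂ ∘ proj₁ ∘ piece-ok)
        (λ d∈ e∈ d≢e → pieces-apart σs longs-apart shorts-apart d∈ e∈ (piece-ok d∈) (piece-ok e∈) d≢e))
      where
      longs-apart : ∀ {i i′} → i ∈ map proj₁ σs → i′ ∈ map proj₁ σs → i ≢ i′ → Apart (g i) (g i′)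
      longs-apart = allPairs⇒distinct apart-sym (AllPairs.map⁻ (subst (AllPairs Apart) longs≡ longsApart))
      shorts-apart : 1 ≤ k → ∀ {i i′} → i ∈ map proj₂ σs → i′ ∈ map proj₂ σs → i ≢ i′ → Apart (g i) (g i′)
      shorts-apart k≥1 = allPairs⇒distinct apart-sym (AllPairs.map⁻ (subst (AllPairs Apart) shorts≡ (shortsApart k≥1)))

    cycle-ok : ∀ {c} → c ∈ F → CycleOK (onWalks c)
    cycle-ok c∈ = All.lookup cycles (∈-map⁺ onWalks c∈)

    chain : ∀ {c} → c ∈ F → Chain (start (cycleWalk c)) (start (cycleWalk c)) (map walkOf (piecesOf (toList c)))
    chain {(l , s) ∷ σs′} c∈ = cycle-chain l l s σs′ (CycleOK.linking (cycle-ok c∈))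

    closed : ∀ {c} → c ∈ F → term (cycleWalk c) ≡ start (cycleWalk c)
    closed c∈ = chain-lastV (chain c∈)

    piece-of-cycle : ∀ {c d} → c ∈ F → d ∈ piecesOf (toList c) → d ∈ piecesOf σs
    piece-of-cycle {d = d} c∈ d∈ = subst (d ∈_) (sym (piecesOf-concatMap toList F))
      (∈-concatMap⁺ (piecesOf ∘ toList) (Any.map (λ { refl → d∈ }) c∈))

    linked : ∀ {c} → c ∈ F → Linked (Arc m) (verts (cycleWalk c))
    linked c∈ = chain-linked (chain c∈)
      (All.map⁺ (All.tabulate λ d∈ → proj₁ (proj₁ (piece-ok (piece-of-cycle c∈ d∈)))))

    vertices↭ : concatMap rest (map cycleWalk F) ↭ concatMap srcAndInternal (map walkOf (piecesOf σs))
    vertices↭ = begin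
      concatMap rest (map cycleWalk F)
        ≡⟨ concatMap-map rest cycleWalk F ⟩
      concatMap (rest ∘ cycleWalk) F
        ↭⟨ concatMap-↭ F (λ c∈ → ↭-trans (closed-rest↭srcAndInternal _ (closed c∈))
                                          (↭-reflexive (chain-initV (chain c∈)))) ⟩
      concatMap (λ c → concatMap srcAndInternal (map walkOf (piecesOf (toList c)))) F
        ≡⟨ gather srcAndInternal toList F ⟩
      concatMap srcAndInternal (map walkOf (piecesOf σs)) ∎
      where open PermutationReasoning

    arcs≡ : concatMap arcs (map cycleWalk F) ≡ concatMap arcs (map walkOf (piecesOf σs))
    arcs≡ = trans (concatMap-map arcs cycleWalk F)
      (trans (concatMap-cong-∈ F (chain-arcs ∘ chain)) (gather arcs toList F))

    unique-vertices : Unique (indices σs) → Unique (concatMap rest (map cycleWalk F))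
    unique-vertices u = unique-resp-↭ (↭-sym vertices↭) (pieces-vertices-unique u)

  module Layout (layout : List (List (List⁺ (I × I))))
                (layout-ok : All (FactorOK ∘ map onWalks) layout)
                (indices-unique : Unique (indices (concatMap (concatMap toList) layout)))
                (two-cycles : All (λ F → length F ≡ 2) layout)
                (five-factors : length layout ≡ 5)
                (arcs-disjoint : ∀ {i i′} → i ≢ i′ → Disjoint (arcs (g i)) (arcs (g i′))) where

    module _ {F} (F∈ : F ∈ layout) where
      open Factor F (All.lookup layout-ok F∈) public

    factors : List (List (Walk m))
    factors = map (map cycleWalk) layout

    allPieces : List Piece
    allPieces = piecesOf (concatMap (concatMap toList) layout)

    factor-indices-unique : ∀ {F} → F ∈ layout → Unique (indices (concatMap toList F))
    factor-indices-unique F∈ = concatMap-unique⁻ (indices ∘ concatMap toList) F∈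
      (subst Unique (trans (cong (map proj₁) (kinded-concatMap (concatMap toList) layout))
                           (map-concatMap proj₁ (kinded ∘ concatMap toList) layout)) indices-unique)

    len-cycle : ∀ {F c} → F ∈ layout → c ∈ F → len (cycleWalk c) ≡ m
    len-cycle {c = c} F∈ c∈ = len-cycleWalk c (cycle-ok F∈ c∈)

    factor-length : ∀ {F} → F ∈ layout → ∀ {X : Set} (f : Walk m → List X) →
                    (∀ {c} → c ∈ F → length (f (cycleWalk c)) ≡ m) → length (concatMap f (map cycleWalk F)) ≡ 2 * m
    factor-length {F} F∈ f len-f = trans (length-concatMap (map cycleWalk F) λ C∈ → of-cycle (∈-map⁻ cycleWalk C∈))
                                         (cong (_* m) (trans (length-map cycleWalk F) (All.lookup two-cycles F∈)))
      where
      of-cycle : ∀ {C} → ∃ (λ c → c ∈ F × C ≡ cycleWalk c) → length (f C) ≡ m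
      of-cycle (c , c∈ , refl) = len-f c∈

    private
      1≤m : 1 ≤ m
      1≤m = n≢0⇒n>0 (≢-nonZero⁻¹ m)

      factor-of : ∀ {Fw} → Fw ∈ factors → ∃ λ F → F ∈ layout × Fw ≡ map cycleWalk F
      factor-of = ∈-map⁻ (map cycleWalk)

    factor-unique : ∀ {F} → F ∈ layout → Unique (concatMap rest (map cycleWalk F))
    factor-unique F∈ = unique-vertices F∈ (factor-indices-unique F∈)

    is-cycle : ∀ {F c} → F ∈ layout → c ∈ F → IsDirCycle m (cycleWalk c) × len (cycleWalk c) ≡ m
    is-cycle F∈ c∈ = (linked F∈ c∈ , closed F∈ c∈
                     , concatMap-unique⁻ rest (∈-map⁺ cycleWalk c∈) (factor-unique F∈)
                     , subst (1 ≤_) (sym (len-cycle F∈ c∈)) 1≤m)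
                   , len-cycle F∈ c∈

    spans : ∀ {F} → F ∈ layout → ∀ v → v ∈ concatMap rest (map cycleWalk F)
    spans F∈ v = ⊆-length⇒⊇ _≟ᵛ_ (factor-unique F∈) (λ _ → ∈-allVertices _)
      (≤-reflexive (trans length-allVertices (sym (trans (factor-length F∈ rest (len-cycle F∈))
                                                         (cong (m +_) (+-identityʳ m))))))
      (∈-allVertices v)

    arcs-of-factors : concatMap (concatMap arcs) factors ≡ concatMap (arcs ∘ walkOf) allPieces
    arcs-of-factors = begin
      concatMap (concatMap arcs) (map (map cycleWalk) layout)
        ≡⟨ concatMap-map (concatMap arcs) (map cycleWalk) layout ⟩
      concatMap (concatMap arcs ∘ map cycleWalk) layout
        ≡⟨ concatMap-cong-∈ layout arcs≡ ⟩
      concatMap (λ F → concatMap arcs (map walkOf (piecesOf (concatMap toList F)))) layout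
        ≡⟨ gather arcs (concatMap toList) layout ⟩
      concatMap arcs (map walkOf allPieces)
        ≡⟨ concatMap-map arcs walkOf allPieces ⟩
      concatMap (arcs ∘ walkOf) allPieces ∎
      where open ≡-Reasoning

    allPieces-ok : ∀ {d} → d ∈ allPieces → PieceOK d
    allPieces-ok {d} d∈ with find (∈-concatMap⁻ (piecesOf ∘ concatMap toList)
                                       (subst (d ∈_) (piecesOf-concatMap (concatMap toList) layout) d∈))
    ... | F , F∈ , d∈F = piece-ok F∈ d∈F

    arcs-once : Unique (concatMap (concatMap arcs) factors)
    arcs-once = subst Unique (sym arcs-of-factors)
      (concatMap-unique (unique-pieces (concatMap (concatMap toList) layout) indices-unique)
        (λ {d} d∈ → arcs-unique (walkOf d) (proj₂ (proj₁ (allPieces-ok d∈))))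
        (λ d∈ e∈ → pieces-arcs-disjoint arcs-disjoint (allPieces-ok d∈) (allPieces-ok e∈)))

    arcs-all : ∀ u v → Arc m u v → (u , v) ∈ concatMap (concatMap arcs) factors
    arcs-all u v uv = ⊆-length⇒⊇ _≟ᵃ_ arcs-once in-graph (≤-reflexive length≡) (∈-allArcs uv)
      where
      in-graph : ∀ {a} → a ∈ concatMap (concatMap arcs) factors → a ∈ allArcs
      in-graph {a} a∈ with find (∈-concatMap⁻ (concatMap arcs) {xs = factors} a∈)
      ... | Fw , Fw∈ , a∈Fw with factor-of Fw∈ | find (∈-concatMap⁻ arcs {xs = Fw} a∈Fw)
      ...   | F , F∈ , refl | C , C∈ , a∈C with ∈-map⁻ cycleWalk C∈
      ...     | c , c∈ , refl = ∈-allArcs (arc-of-linked (cycleWalk c) (linked F∈ c∈) a∈C)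
      factor-arcs : ∀ {Fw} → Fw ∈ factors → length (concatMap arcs Fw) ≡ 2 * m
      factor-arcs Fw∈ with factor-of Fw∈
      ... | F , F∈ , refl = factor-length F∈ arcs λ {c} c∈ →
            trans (length-arcsFrom (start (cycleWalk c)) (rest (cycleWalk c))) (len-cycle F∈ c∈)
      length≡ : length allArcs ≡ length (concatMap (concatMap arcs) factors)
      length≡ = begin
        length allArcs                               ≡⟨ length-allArcs ⟩
        (m + m) * 5                                  ≡⟨ solve 1 (λ m → (m :+ m) :* con 5 := con 5 :* (con 2 :* m)) refl m ⟩
        5 * (2 * m)                                  ≡⟨ cong (_* (2 * m)) (sym length-factors) ⟩
        length factors * (2 * m)                     ≡⟨ sym (length-concatMap factors factor-arcs) ⟩
        length (concatMap (concatMap arcs) factors)  ∎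
        where
        open ≡-Reasoning
        open +-*-Solver using (solve; _:+_; _:*_; _:=_; con)
        length-factors : length factors ≡ 5
        length-factors = trans (length-map (map cycleWalk) layout) five-factors

    factorization : CmFactorization m
    factorization = record
      { factors   = factors
      ; cycles    = λ Fw∈ C∈ → on-cycle Fw∈ C∈
      ; spanning  = λ Fw∈ v → on-factor Fw∈ (λ F∈ → spans F∈ v)
      ; vdisjoint = λ Fw∈ → on-factor Fw∈ factor-unique
      ; arcsOnce  = arcs-once
      ; arcsAll   = arcs-all
      }
      where
      on-factor : ∀ {Fw} {P : List (Walk m) → Set} → Fw ∈ factors →
                  (∀ {F} → F ∈ layout → P (map cycleWalk F)) → P Fw
      on-factor Fw∈ h with factor-of Fw∈
      ... | F , F∈ , refl = h F∈
      on-cycle : ∀ {Fw C} → Fw ∈ factors → C ∈ Fw → IsDirCycle m C × len C ≡ m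
      on-cycle Fw∈ C∈ with factor-of Fw∈
      ... | F , F∈ , refl with ∈-map⁻ cycleWalk C∈
      ...   | c , c∈ , refl = is-cycle F∈ c∈


zero-or-positive : ∀ n → n ≡ 0 ⊎ 1 ≤ n
zero-or-positive zero    = inj₁ refl
zero-or-positive (suc n) = inj₂ (s≤s z≤n)

allowed-p⇒1≤p : ∀ {p} → p ≡ 11 ⊎ p ≡ 13 ⊎ p ≡ 17 ⊎ p ≡ 19 → 1 ≤ p
allowed-p⇒1≤p (inj₁ refl)               = s≤s z≤n
allowed-p⇒1≤p (inj₂ (inj₁ refl))        = s≤s z≤n
allowed-p⇒1≤p (inj₂ (inj₂ (inj₁ refl))) = s≤s z≤n
allowed-p⇒1≤p (inj₂ (inj₂ (inj₂ refl))) = s≤s z≤n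

lemma18 : (p k : ℕ) → (p ≡ 11 ⊎ p ≡ 13 ⊎ p ≡ 17 ⊎ p ≡ 19)
          → (A B C : Type2Basic p k) → (D E : Type1Basic p k)
          → PairwiseArcDisjoint (Type2Basic.walks A ++ Type2Basic.walks B ++ Type2Basic.walks C
                                 ++ Type1Basic.walks D ++ Type1Basic.walks E)
          → CmFactorization (p + 12 * k)
lemma18 p k p-allowed A B C D E H =
  Layout.factorization layout
    (Type2.factorOK A k≡0∨k≥1 ∷ Type2.factorOK B k≡0∨k≥1 ∷ Type2.factorOK C k≡0∨k≥1
     ∷ Type1.factorOK D k≡0∨k≥1 ∷ Type1.factorOK E k≡0∨k≥1 ∷ [])
    (toWitness {a? = unique? (indices (concatMap (concatMap toList) layout))} _)
    (refl ∷ refl ∷ refl ∷ refl ∷ refl ∷ []) refl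
    (λ i≢j (a∈ , b∈) → H _ _ i≢j a∈ b∈)
  where
  instance
    m≢0 : NonZero (p + 12 * k)
    m≢0 = >-nonZero (≤-trans (allowed-p⇒1≤p p-allowed) (m≤m+n p (12 * k)))

  walks : List (Walk (p + 12 * k))
  walks = Type2Basic.walks A ++ Type2Basic.walks B ++ Type2Basic.walks C ++ Type1Basic.walks D ++ Type1Basic.walks E

  open BasicSets p k
  open Factorization p k (lookup walks)

  k≡0∨k≥1 : k ≡ 0 ⊎ 1 ≤ k
  k≡0∨k≥1 = zero-or-positive k

  -- Positions in `walks` of the (long, short) segments of each cycle of each factor.
  layout : List (List (List⁺ (Fin 32 × Fin 32)))
  layout = (((# 0 , # 4) ∷ (# 1 , # 5) ∷ []) ∷ ((# 2 , # 6) ∷ (# 3 , # 7) ∷ []) ∷ [])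
         ∷ (((# 8 , # 12) ∷ (# 9 , # 13) ∷ []) ∷ ((# 10 , # 14) ∷ (# 11 , # 15) ∷ []) ∷ [])
         ∷ (((# 16 , # 20) ∷ (# 17 , # 21) ∷ []) ∷ ((# 18 , # 22) ∷ (# 19 , # 23) ∷ []) ∷ [])
         ∷ (((# 24 , # 26) ∷ []) ∷ ((# 25 , # 27) ∷ []) ∷ [])
         ∷ (((# 28 , # 30) ∷ []) ∷ ((# 29 , # 31) ∷ []) ∷ [])
         ∷ []
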